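{- Let $X$ and $Y$ be finite disjoint sets, $Z \subseteq Y$, $Q$ a partial order relation on $Z$, and $R \in \mathfrak{U}(X,Y) \cap \mathfrak{C}_Q(X \cup (Y\setminus Z), Z)$. If $Y \subseteq \downarrow_R Z$, then $R \in \mathfrak{M}_Q(X \cup (Y \setminus Z), Z)$.
   Context: A partial order relation (p.o.r.) on $S$ is a reflexive, antisymmetric, transitive subset of $S\times S$; $\mathfrak{P}(S)$ is the set of p.o.r.s on $S$. $R|_M = R\cap(M\times M)$; $\downarrow_R M = \{x : (x,m)\in R \text{ for some } m \in M\}$. Upper end: $U$ with $u\in U$, $(u,x)\in R\Rightarrow x\in U$. Convex: $(a,x),(x,b)\in R$, $a,b\in M$ imply $x\in M$. For disjoint sets $A,B$ and a p.o.r. $Q'$ on $B$: $\mathfrak{U}(A,B) = \{R\in\mathfrak{P}(A\cup B) : B \text{ is an upper end of } R\}$; $\mathfrak{C}_{Q'}(A,B) = \{R\in\mathfrak{P}(A\cup B) : R|_B = Q',\ B \text{ convex in } R\}$; $\mathfrak{M}_{Q'}(A,B) = \mathfrak{U}(A,B)\cap\mathfrak{C}_{Q'}(A,B)$. -}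

module Defs where

open import Data.Nat using (ℕ)
open import Data.Fin using (Fin)
open import Data.Fin.Subset using (Subset; _∈_; _∉_; _∪_)
open import Data.Product using (_×_; ∃; ∃-syntax)
open import Relation.Binary.PropositionalEquality using (_≡_)

-- The ambient finite universe is Fin n; all sets are subsets of it
-- (hence finite). A relation is an arbitrary binary predicate on Fin n.
Relation : ℕ → Set₁
Relation n = Fin n → Fin n → Set

module _ {n : ℕ} where

  IsRelOn : Subset n → Relation n → Set
  IsRelOn S R = ∀ x y → R x y → (x ∈ S) × (y ∈ S)

  IsPOR : Subset n → Relation n → Set
  IsPOR S R =
    IsRelOn S R
    × (∀ x → x ∈ S → R x x)
    × (∀ x y → R x y → R y x → x ≡ y)
    × (∀ x y z → R x y → R y z → R x z)

  restrict : Relation n → Subset n → Relation n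
  restrict R M x y = R x y × (x ∈ M) × (y ∈ M)

  _≐_ : Relation n → Relation n → Set
  R ≐ Q = ∀ x y → (R x y → Q x y) × (Q x y → R x y)

  ↓ : Relation n → Subset n → Fin n → Set
  ↓ R M x = ∃[ m ] ((m ∈ M) × R x m)

  IsUpperEnd : Relation n → Subset n → Set
  IsUpperEnd R U = ∀ u x → u ∈ U → R u x → x ∈ U

  IsConvex : Relation n → Subset n → Set
  IsConvex R M = ∀ a x b → a ∈ M → b ∈ M → R a x → R x b → x ∈ M

  InU : Subset n → Subset n → Relation n → Set
  InU A B R = IsPOR (A ∪ B) R × IsUpperEnd R B

  InC : Relation n → Subset n → Subset n → Relation n → Set
  InC Q' A B R = IsPOR (A ∪ B) R × (restrict R B ≐ Q') × IsConvex R B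

  InM : Relation n → Subset n → Subset n → Relation n → Set
  InM Q' A B R = InU A B R × InC Q' A B R

  Disjoint : Subset n → Subset n → Set
  Disjoint A B = ∀ x → x ∈ A → x ∉ B

module Submission where

open import Defs
open import Data.Nat using (ℕ)
open import Data.Fin.Subset using (Subset; _∈_; _⊆_; _∪_; _─_)
open import Data.Product using (_,_)

-- Every x above some u ∈ Z lies in Y, hence below some m ∈ Z; convexity of Z
-- between u and m then puts x in Z.
convex-downset-isUpperEnd : ∀ {n} {Y Z : Subset n} {R : Relation n}
  → IsUpperEnd R Y → Z ⊆ Y → (∀ y → y ∈ Y → ↓ R Z y)
  → IsConvex R Z → IsUpperEnd R Z
convex-downset-isUpperEnd upY Z⊆Y Y⊆↓Z convZ u x u∈Z Rux
  with Y⊆↓Z x (upY u x (Z⊆Y u∈Z) Rux)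
... | m , m∈Z , Rxm = convZ u x m u∈Z m∈Z Rux Rxm

corollary2 : (n : ℕ) (X Y Z : Subset n) (Q R : Relation n)
    → Disjoint X Y
    → Z ⊆ Y
    → IsPOR Z Q
    → InU X Y R
    → InC Q (X ∪ (Y ─ Z)) Z R
    → (∀ y → y ∈ Y → ↓ R Z y)
    → InM Q (X ∪ (Y ─ Z)) Z R
corollary2 n X Y Z Q R _ Z⊆Y _ (_ , upY) inC@(porR , _ , convZ) Y⊆↓Z =
  (porR , convex-downset-isUpperEnd upY Z⊆Y Y⊆↓Z convZ) , inC
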